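{- In $\mathsf{ITT}$, the following are logically equivalent: (1) for all types $A,B$, the map $\mathrm{CEqToEq}:(A\cong B)\to(A\simeq B)$ is an equivalence; (2) for all types $A,B$, $\mathrm{CEqToEq}:(A\cong B)\to(A\simeq B)$ admits a homotopy section; (3) for all types $A,B$ and every $f:A\to B$, the type $\mathrm{isEquiv}(f)$ is a proposition; (4) for every type $A$ and $f:A\to A$, if $f\sim\mathrm{id}_A$ then $f=\mathrm{id}_A$; (5) for all types $A,B$ and every $f:A\to B$, we have $\mathrm{isEquiv}(f)\to\mathrm{isCEq}(f)$; (6) for all types $A,B$ and every $f:A\to B$, we have $\mathrm{isEquiv}(f)\to\mathrm{isEquiv}(f_*)$, where $f_*:(X\to A)\to(X\to B)$ is post-composition with $f$, for every type $X$; (7) (weak function extensionality) for every family of contractible types $a:A\vdash P(a)$, the type $\prod_{a:A}P(a)$ is contractible; (8) (function extensionality) for every family $a:A\vdash B(a)$ and $f,g:\prod_{a:A}B(a)$, the canonical map $(f=g)\to(f\sim g)$ is an equivalence.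
   Context: $\mathsf{ITT}$ is intensional Martin-Löf type theory with $\Sigma$, $\Pi$, intensional identity types, binary coproducts, empty and unit types and a universe, with strict $\beta$-rules and strict $\eta$-rules for $\Sigma$, $\Pi$ and unit types. "Types" here range over all (possibly large) types. $f\sim g:=\prod_{a}fa=ga$. $\mathrm{isEquiv}(f)$ is the type of $(s,S,r,R)$ with $s,r:B\to A$, $S:f\circ s\sim\mathrm{id}_B$, $R:r\circ f\sim\mathrm{id}_A$; $A\simeq B:=\sum_{f}\mathrm{isEquiv}(f)$. $\mathrm{isCEq}(f)$ is the type of $(s,S,r,R)$ with $S: f\circ s =_{B\to B}\mathrm{id}_B$ and $R: r\circ f=_{A\to A}\mathrm{id}_A$ (categorical equivalence); $A\cong B:=\sum_f \mathrm{isCEq}(f)$. $\mathrm{CEqToEq}$ sends $(f,s,S,r,R)$ to $(f,s,\mathrm{happly}(S),r,\mathrm{happly}(R))$, where $\mathrm{happly}:(g=h)\to(g\sim h)$ is defined by path induction. -}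

{-# OPTIONS --without-K #-}
module Defs where

open import Level using (Level; _⊔_; Setω)
open import Data.Product using (Σ; Σ-syntax; _×_; _,_)
open import Relation.Binary.PropositionalEquality using (_≡_; refl)
open import Function using (_∘_; id)

private variable
  a b p : Level

_∼_ : {A : Set a} {B : A → Set b} → ((x : A) → B x) → ((x : A) → B x) → Set (a ⊔ b)
f ∼ g = ∀ x → f x ≡ g x
infix 4 _∼_

happly : {A : Set a} {B : A → Set b} {f g : (x : A) → B x} → f ≡ g → f ∼ g
happly refl x = refl

isEquiv : {A : Set a} {B : Set b} → (A → B) → Set (a ⊔ b)
isEquiv {A = A} {B} f = Σ[ s ∈ (B → A) ] (f ∘ s ∼ id) × Σ[ r ∈ (B → A) ] (r ∘ f ∼ id)

_≃_ : Set a → Set b → Set (a ⊔ b)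
A ≃ B = Σ[ f ∈ (A → B) ] isEquiv f

isCEq : {A : Set a} {B : Set b} → (A → B) → Set (a ⊔ b)
isCEq {A = A} {B} f = Σ[ s ∈ (B → A) ] (f ∘ s ≡ id) × Σ[ r ∈ (B → A) ] (r ∘ f ≡ id)

_≅_ : Set a → Set b → Set (a ⊔ b)
A ≅ B = Σ[ f ∈ (A → B) ] isCEq f

CEqToEq : {A : Set a} {B : Set b} → A ≅ B → A ≃ B
CEqToEq (f , s , S , r , R) = f , s , happly S , r , happly R

isContr : Set a → Set a
isContr A = Σ[ c ∈ A ] (∀ x → c ≡ x)

isProp : Set a → Set a
isProp A = (x y : A) → x ≡ y

hasSection : {A : Set a} {B : Set b} → (A → B) → Set (a ⊔ b)
hasSection {A = A} {B} f = Σ[ s ∈ (B → A) ] (f ∘ s ∼ id)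

postcomp : {A : Set a} {B : Set b} (X : Set p) → (A → B) → (X → A) → (X → B)
postcomp X f g = f ∘ g

-- The eight conditions, quantified over all universe levels ("all, possibly large, types")
Cond1 Cond2 Cond3 Cond4 Cond5 Cond6 Cond7 Cond8 : Setω
Cond1 = ∀ {a b} {A : Set a} {B : Set b} → isEquiv (CEqToEq {A = A} {B = B})
Cond2 = ∀ {a b} {A : Set a} {B : Set b} → hasSection (CEqToEq {A = A} {B = B})
Cond3 = ∀ {a b} {A : Set a} {B : Set b} (f : A → B) → isProp (isEquiv f)
Cond4 = ∀ {a} {A : Set a} (f : A → A) → f ∼ id → f ≡ id
Cond5 = ∀ {a b} {A : Set a} {B : Set b} (f : A → B) → isEquiv f → isCEq f
Cond6 = ∀ {a b} {A : Set a} {B : Set b} (f : A → B) → isEquiv f →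
          ∀ {x} (X : Set x) → isEquiv (postcomp X f)
Cond7 = ∀ {a p} {A : Set a} (P : A → Set p) → (∀ x → isContr (P x)) → isContr ((x : A) → P x)
Cond8 = ∀ {a b} {A : Set a} (B : A → Set b) (f g : (x : A) → B x) → isEquiv (happly {f = f} {g = g})

record _⇔ω_ (P Q : Setω) : Setω where
  field
    to   : P → Q
    from : Q → P
infix 2 _⇔ω_

record _∧ω_ (P Q : Setω) : Setω where
  constructor _,ω_
  field
    fst : P
    snd : Q
infixr 1 _∧ω_

{-# OPTIONS --safe --without-K #-}

-- Each of (1)-(6) forces the homotopy diag ∘ source ∼ id on the free path
-- space Paths B = Σ y z (y ≡ z) to be a path; precomposing that path with
-- x ↦ (f x , g x , h x), for h : f ∼ g, and taking targets gives f ≡ g.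
-- This non-dependent extensionality makes post-composition with the projection
-- Σ A P → A invertible when every P x is contractible, so its fibre over id,
-- of which Π A P is a retract, is contractible (7).  Weak extensionality in
-- turn contracts Σ g (f ∼ g), which makes happly an equivalence (8); and with
-- (8) every homotopy occurring in (1)-(7) can be replaced by a path.
module Submission where

open import Defs
open import Level using (Level; _⊔_; Setω)
open import Data.Product using (Σ; Σ-syntax; _×_; _,_; proj₁; proj₂)
open import Function using (_∘_; id)
open import Relation.Binary.PropositionalEquality
  using (_≡_; refl; sym; trans; cong; cong₂; subst)
open import Relation.Binary.PropositionalEquality.Properties
  using (trans-symˡ; subst-sym-subst)

private variable
  a b c : Level

refl-htpy : {A : Set a} {B : A → Set b} (f : (x : A) → B x) → f ∼ f
refl-htpy f x = refl

isContr⇒isProp : {X : Set a} → isContr X → isProp X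
isContr⇒isProp (_ , K) x y = trans (sym (K x)) (K y)

singleton-isContr : {Y : Set a} (y₀ : Y) → isContr (Σ[ y ∈ Y ] y ≡ y₀)
singleton-isContr y₀ = (y₀ , refl) , λ { (y , refl) → refl }

singletonʳ-isContr : {Y : Set a} (y₀ : Y) → isContr (Σ[ y ∈ Y ] y₀ ≡ y)
singletonʳ-isContr y₀ = (y₀ , refl) , λ { (y , refl) → refl }

×-isContr : {X : Set a} {Y : Set b} → isContr X → isContr Y → isContr (X × Y)
×-isContr (x , K) (y , L) = (x , y) , λ { (x' , y') → cong₂ _,_ (K x') (L y') }

record _◁_ (X : Set a) (Y : Set b) : Set (a ⊔ b) where
  field
    retraction : Y → X
    section    : X → Y
    retraction∘section : retraction ∘ section ∼ id
open _◁_

infix 1 _◁_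

◁-trans : {X : Set a} {Y : Set b} {Z : Set c} → X ◁ Y → Y ◁ Z → X ◁ Z
◁-trans ρ σ = record
  { retraction = retraction ρ ∘ retraction σ
  ; section    = section σ ∘ section ρ
  ; retraction∘section = λ x →
      trans (cong (retraction ρ) (retraction∘section σ (section ρ x))) (retraction∘section ρ x)
  }

◁-isContr : {X : Set a} {Y : Set b} → X ◁ Y → isContr Y → isContr X
◁-isContr ρ (y , K) =
  retraction ρ y , λ x → trans (cong (retraction ρ) (K (section ρ x))) (retraction∘section ρ x)

Σ-◁-fibrewise : {X : Set a} {A : X → Set b} {B : X → Set c} →
  (∀ x → A x ◁ B x) → Σ X A ◁ Σ X B
Σ-◁-fibrewise ρ = record
  { retraction = λ { (x , y) → x , retraction (ρ x) y }
  ; section    = λ { (x , y) → x , section (ρ x) y }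
  ; retraction∘section = λ { (x , y) → cong (x ,_) (retraction∘section (ρ x) y) }
  }

Σ-◁-reindex : {X : Set a} {Y : Set b} (A : X → Set c) (g : Y → X) (f : X → Y) →
  g ∘ f ∼ id → Σ X A ◁ Σ Y (A ∘ g)
Σ-◁-reindex {X = X} A g f η = record
  { retraction = λ { (y , t) → g y , t }
  ; section    = λ { (x , t) → f x , subst A (sym (η x)) t }
  ; retraction∘section = λ { (x , t) → transported (η x) t }
  }
  where
  transported : ∀ {x' x} (e : x' ≡ x) (t : A x) → _≡_ {A = Σ X A} (x' , subst A (sym e) t) (x , t)
  transported refl t = refl

fibre : {X : Set a} {Y : Set b} → (X → Y) → Y → Set (a ⊔ b)
fibre {X = X} f y = Σ[ x ∈ X ] f x ≡ y

hasRetraction : {X : Set a} {Y : Set b} → (X → Y) → Set (a ⊔ b)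
hasRetraction {X = X} {Y} f = Σ[ r ∈ (Y → X) ] (r ∘ f ∼ id)

qinv : {X : Set a} {Y : Set b} → (X → Y) → Set (a ⊔ b)
qinv {X = X} {Y} f = Σ[ g ∈ (Y → X) ] (g ∘ f ∼ id) × (f ∘ g ∼ id)

qinv⇒isEquiv : {X : Set a} {Y : Set b} {f : X → Y} → qinv f → isEquiv f
qinv⇒isEquiv (g , η , ε) = g , ε , g , η

isEquiv⇒qinv : {X : Set a} {Y : Set b} {f : X → Y} → isEquiv f → qinv f
isEquiv⇒qinv {f = f} (s , S , r , R) =
  s , (λ x → trans (sym (R (s (f x)))) (trans (cong r (S (f x))) (R x))) , S

qinv⇒fibre-isContr : {X : Set a} {Y : Set b} {f : X → Y} → qinv f → ∀ y → isContr (fibre f y)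
qinv⇒fibre-isContr {Y = Y} {f} (g , η , ε) y₀ =
  ◁-isContr (◁-trans (Σ-◁-reindex (λ x → f x ≡ y₀) g f η) (Σ-◁-fibrewise transport))
            (singleton-isContr y₀)
  where
  transport : (y : Y) → f (g y) ≡ y₀ ◁ y ≡ y₀
  transport y = record
    { retraction = subst (_≡ y₀) (sym (ε y))
    ; section    = subst (_≡ y₀) (ε y)
    ; retraction∘section = λ _ → subst-sym-subst (ε y)
    }

isContr-total⇒isEquiv : {X : Set a} {R : X → Set b} {x₀ : X} →
  isContr (Σ X R) → (φ : ∀ {x} → x₀ ≡ x → R x) → ∀ {x} → isEquiv (φ {x})
isContr-total⇒isEquiv {X = X} {R} {x₀} total φ = φ⁻¹ , φ∘φ⁻¹ , φ⁻¹ , φ⁻¹∘φ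
  where
  centre : Σ X R
  centre = x₀ , φ refl
  φ⁻¹ : ∀ {x} → R x → x₀ ≡ x
  φ⁻¹ {x} r = cong proj₁ (isContr⇒isProp total centre (x , r))
  φ-cong-proj₁ : ∀ {x} {r : R x} (q : centre ≡ (x , r)) → φ (cong proj₁ q) ≡ r
  φ-cong-proj₁ refl = refl
  φ∘φ⁻¹ : ∀ {x} (r : R x) → φ (φ⁻¹ r) ≡ r
  φ∘φ⁻¹ r = φ-cong-proj₁ (isContr⇒isProp total centre (_ , r))
  φ⁻¹∘φ : ∀ {x} (p : x₀ ≡ x) → φ⁻¹ (φ p) ≡ p
  φ⁻¹∘φ refl = cong (cong proj₁) (trans-symˡ (proj₂ total centre))

Paths : Set a → Set a
Paths B = Σ[ y ∈ B ] Σ[ z ∈ B ] y ≡ z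

diag : {B : Set a} → B → Paths B
diag y = y , y , refl

source : {B : Set a} → Paths B → B
source = proj₁

target : {B : Set a} → Paths B → B
target = proj₁ ∘ proj₂

diag∘source∼id : {B : Set a} → diag ∘ source ∼ id {A = Paths B}
diag∘source∼id (y , .y , refl) = refl

source-isEquiv : {B : Set a} → isEquiv (source {B = B})
source-isEquiv = qinv⇒isEquiv (diag , diag∘source∼id , refl-htpy id)

DiagSourceId : Setω
DiagSourceId = ∀ {b} {B : Set b} → diag ∘ source ≡ id {A = Paths B}

NonDependentFunExt : Setω
NonDependentFunExt = ∀ {a b} {A : Set a} {B : Set b} {f g : A → B} → f ∼ g → f ≡ g

diagSourceId⇒nonDependentFunExt : DiagSourceId → NonDependentFunExt
diagSourceId⇒nonDependentFunExt diag∘source≡id {f = f} {g} h =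
  cong (λ m → target ∘ m ∘ (λ x → f x , g x , h x)) diag∘source≡id

nonDependentFunExt⇒weakFunExt : NonDependentFunExt → Cond7
nonDependentFunExt⇒weakFunExt funext {A = A} P P-isContr =
  ◁-isContr Π◁fibre (qinv⇒fibre-isContr (pre , pre∘post , refl-htpy id) id)
  where
  post : (A → Σ A P) → (A → A)
  post m = proj₁ ∘ m
  pre : (A → A) → (A → Σ A P)
  pre u x = u x , proj₁ (P-isContr (u x))
  pre∘post : pre ∘ post ∼ id
  pre∘post m = funext λ x → cong (proj₁ (m x) ,_) (proj₂ (P-isContr (proj₁ (m x))) (proj₂ (m x)))
  Π◁fibre : ((x : A) → P x) ◁ fibre post id
  Π◁fibre = record
    { retraction = λ { (m , e) x → subst P (happly e x) (proj₂ (m x)) }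
    ; section    = λ φ → (λ x → x , φ x) , refl
    ; retraction∘section = refl-htpy id
    }

weakFunExt⇒funExt : Cond7 → Cond8
weakFunExt⇒funExt weakFunExt {A = A} B f g = isContr-total⇒isEquiv homotopies-isContr happly
  where
  homotopies-isContr : isContr (Σ[ g' ∈ ((x : A) → B x) ] f ∼ g')
  homotopies-isContr = ◁-isContr
    (record
      { retraction = λ φ → proj₁ ∘ φ , proj₂ ∘ φ
      ; section    = λ { (g' , h) x → g' x , h x }
      ; retraction∘section = refl-htpy id
      })
    (weakFunExt (λ x → Σ[ y ∈ B x ] f x ≡ y) (singletonʳ-isContr ∘ f))

diagSourceId⇒funExt : DiagSourceId → Cond8
diagSourceId⇒funExt diag∘source≡id =
  weakFunExt⇒funExt (nonDependentFunExt⇒weakFunExt (diagSourceId⇒nonDependentFunExt diag∘source≡id))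

cond1⇒cond2 : Cond1 → Cond2
cond1⇒cond2 CEqToEq-isEquiv = proj₁ CEqToEq-isEquiv , proj₁ (proj₂ CEqToEq-isEquiv)

CEqToEq-section⇒section-path : {A : Set a} {B : Set b} → hasSection (CEqToEq {A = A} {B}) →
  (e : A ≃ B) → proj₁ e ∘ proj₁ (proj₂ e) ≡ id
CEqToEq-section⇒section-path (lift , CEqToEq∘lift∼id) e =
  trans (sym (cong (λ e → proj₁ e ∘ proj₁ (proj₂ e)) (CEqToEq∘lift∼id e)))
        (proj₁ (proj₂ (proj₂ (lift e))))

cond2⇒cond4 : Cond2 → Cond4
cond2⇒cond4 CEqToEq-hasSection f f∼id =
  CEqToEq-section⇒section-path CEqToEq-hasSection (f , id , f∼id , id , f∼id)

cond3⇒cond4 : Cond3 → Cond4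
cond3⇒cond4 isEquiv-isProp f f∼id =
  cong proj₁ (isEquiv-isProp id (f , f∼id , f , f∼id) (id , refl-htpy id , id , refl-htpy id))

cond4⇒diagSourceId : Cond4 → DiagSourceId
cond4⇒diagSourceId htpy⇒path = htpy⇒path (diag ∘ source) diag∘source∼id

-- Since source ∘ diag = id holds definitionally, r ≡ r ∘ source ∘ diag ≡ diag.
source-retraction⇒diag∘source≡id : {B : Set b} {r : B → Paths B} →
  r ∘ source ≡ id → diag ∘ source ≡ id
source-retraction⇒diag∘source≡id {r = r} r∘source≡id =
  trans (cong (_∘ source) (sym r≡diag)) r∘source≡id
  where
  r≡diag : r ≡ diag
  r≡diag = cong (_∘ diag) r∘source≡id

cond5⇒diagSourceId : Cond5 → DiagSourceId
cond5⇒diagSourceId isEquiv⇒isCEq {B = B} with isEquiv⇒isCEq (source {B = B}) source-isEquiv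
... | _ , _ , _ , r∘source≡id = source-retraction⇒diag∘source≡id r∘source≡id

-- ρ (source ∘ diag ∘ source) and ρ (source ∘ id) are both ρ source, definitionally.
cond6⇒diagSourceId : Cond6 → DiagSourceId
cond6⇒diagSourceId postcomp-isEquiv {B = B}
  with postcomp-isEquiv (source {B = B}) source-isEquiv (Paths B)
... | _ , _ , ρ , ρ∘postcomp∼id = trans (sym (ρ∘postcomp∼id (diag ∘ source))) (ρ∘postcomp∼id id)

module FunExt (happly-isEquiv : Cond8) where

  private
    happly-qinv : ∀ {a b} {A : Set a} {B : A → Set b} {f g : (x : A) → B x} →
      qinv (happly {f = f} {g})
    happly-qinv {B = B} {f} {g} = isEquiv⇒qinv (happly-isEquiv B f g)

  funext : {A : Set a} {B : A → Set b} {f g : (x : A) → B x} → f ∼ g → f ≡ g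
  funext = proj₁ happly-qinv

  funext-happly : {A : Set a} {B : A → Set b} {f g : (x : A) → B x}
    (p : f ≡ g) → funext (happly p) ≡ p
  funext-happly = proj₁ (proj₂ happly-qinv)

  happly-funext : {A : Set a} {B : A → Set b} {f g : (x : A) → B x}
    (h : f ∼ g) → happly (funext h) ≡ h
  happly-funext = proj₂ (proj₂ happly-qinv)

  postcomp-qinv : {A : Set a} {B : Set b} {f : A → B} → qinv f →
    (X : Set c) → qinv (postcomp X f)
  postcomp-qinv (g , η , ε) _ = g ∘_ , (λ m → funext (η ∘ m)) , (λ m → funext (ε ∘ m))

  precomp-qinv : {A : Set a} {B : Set b} {f : A → B} → qinv f →
    (X : Set c) → qinv (λ (m : B → X) → m ∘ f)
  precomp-qinv (g , η , ε) _ = _∘ g , (λ m → funext (cong m ∘ ε)) , (λ m → funext (cong m ∘ η))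

  ∼◁≡ : {A : Set a} {B : A → Set b} {f g : (x : A) → B x} → f ∼ g ◁ f ≡ g
  ∼◁≡ = record { retraction = happly ; section = funext ; retraction∘section = happly-funext }

  isEquiv-isContr : {A : Set a} {B : Set b} {f : A → B} → isEquiv f → isContr (isEquiv f)
  isEquiv-isContr {B = B} {f} e = ◁-isContr isEquiv◁× (×-isContr sections retractions)
    where
    isEquiv◁× : isEquiv f ◁ hasSection f × hasRetraction f
    isEquiv◁× = record
      { retraction = λ { ((s , S) , (r , R)) → s , S , r , R }
      ; section    = λ { (s , S , r , R) → (s , S) , (r , R) }
      ; retraction∘section = refl-htpy id
      }
    sections : isContr (hasSection f)
    sections = ◁-isContr (Σ-◁-fibrewise λ _ → ∼◁≡)
                         (qinv⇒fibre-isContr (postcomp-qinv (isEquiv⇒qinv e) B) id)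
    retractions : isContr (hasRetraction f)
    retractions = ◁-isContr (Σ-◁-fibrewise λ _ → ∼◁≡)
                            (qinv⇒fibre-isContr (precomp-qinv (isEquiv⇒qinv e) _) id)

  cond1 : Cond1
  cond1 = qinv⇒isEquiv (CEqToEq⁻¹ , CEqToEq⁻¹∘CEqToEq , CEqToEq∘CEqToEq⁻¹)
    where
    CEqToEq⁻¹ : {A : Set a} {B : Set b} → A ≃ B → A ≅ B
    CEqToEq⁻¹ (f , s , S , r , R) = f , s , funext S , r , funext R
    CEqToEq⁻¹∘CEqToEq : {A : Set a} {B : Set b} (e : A ≅ B) → CEqToEq⁻¹ (CEqToEq e) ≡ e
    CEqToEq⁻¹∘CEqToEq (f , s , S , r , R) =
      cong₂ (λ S' R' → f , s , S' , r , R') (funext-happly S) (funext-happly R)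
    CEqToEq∘CEqToEq⁻¹ : {A : Set a} {B : Set b} (e : A ≃ B) → CEqToEq (CEqToEq⁻¹ e) ≡ e
    CEqToEq∘CEqToEq⁻¹ (f , s , S , r , R) =
      cong₂ (λ S' R' → f , s , S' , r , R') (happly-funext S) (happly-funext R)

  cond3 : Cond3
  cond3 _ e = isContr⇒isProp (isEquiv-isContr e) e

  cond4 : Cond4
  cond4 _ = funext

  cond5 : Cond5
  cond5 _ (s , S , r , R) = s , funext S , r , funext R

  cond6 : Cond6
  cond6 _ e X = qinv⇒isEquiv (postcomp-qinv (isEquiv⇒qinv e) X)

  cond7 : Cond7
  cond7 = nonDependentFunExt⇒weakFunExt funext

cond1⇔funExt : Cond1 ⇔ω Cond8
cond1⇔funExt = record
  { to   = λ c → diagSourceId⇒funExt (cond4⇒diagSourceId (cond2⇒cond4 (cond1⇒cond2 c)))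
  ; from = FunExt.cond1
  }

cond2⇔funExt : Cond2 ⇔ω Cond8
cond2⇔funExt = record
  { to   = λ c → diagSourceId⇒funExt (cond4⇒diagSourceId (cond2⇒cond4 c))
  ; from = λ fe → cond1⇒cond2 (FunExt.cond1 fe)
  }

cond3⇔funExt : Cond3 ⇔ω Cond8
cond3⇔funExt = record
  { to   = λ c → diagSourceId⇒funExt (cond4⇒diagSourceId (cond3⇒cond4 c))
  ; from = FunExt.cond3
  }

cond4⇔funExt : Cond4 ⇔ω Cond8
cond4⇔funExt = record
  { to   = λ c → diagSourceId⇒funExt (cond4⇒diagSourceId c)
  ; from = FunExt.cond4
  }

cond5⇔funExt : Cond5 ⇔ω Cond8
cond5⇔funExt = record
  { to   = λ c → diagSourceId⇒funExt (cond5⇒diagSourceId c)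
  ; from = FunExt.cond5
  }

cond6⇔funExt : Cond6 ⇔ω Cond8
cond6⇔funExt = record
  { to   = λ c → diagSourceId⇒funExt (cond6⇒diagSourceId c)
  ; from = FunExt.cond6
  }

cond7⇔funExt : Cond7 ⇔ω Cond8
cond7⇔funExt = record
  { to   = weakFunExt⇒funExt
  ; from = FunExt.cond7
  }

theorem2p13 : (Cond1 ⇔ω Cond2) ∧ω (Cond1 ⇔ω Cond3) ∧ω (Cond1 ⇔ω Cond4) ∧ω (Cond1 ⇔ω Cond5)
    ∧ω (Cond1 ⇔ω Cond6) ∧ω (Cond1 ⇔ω Cond7) ∧ω (Cond1 ⇔ω Cond8)
theorem2p13 =
  via cond2⇔funExt ,ω (via cond3⇔funExt ,ω (via cond4⇔funExt ,ω (via cond5⇔funExt ,ω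
  (via cond6⇔funExt ,ω (via cond7⇔funExt ,ω cond1⇔funExt)))))
  where
  via : {P : Setω} → P ⇔ω Cond8 → Cond1 ⇔ω P
  via P⇔funExt = record
    { to   = λ c → _⇔ω_.from P⇔funExt (_⇔ω_.to cond1⇔funExt c)
    ; from = λ p → _⇔ω_.from cond1⇔funExt (_⇔ω_.to P⇔funExt p)
    }
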